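{- Let $D$ be a strongly connected spanning subdigraph of $\overleftrightarrow{C_n}$ having $k\ge 1$ asymmetric arcs. Then $rc^*(D)=n-1$ if $k\le 2$, and $rc^*(D)=n$ if $k\ge 3$. Moreover, if $k\ge 3$ then $rc^*(D)=src^*(D)=n$.
   Context: $\overleftrightarrow{C_n}$ is the biorientation of the cycle $C_n$ on $n$ vertices (each edge $uv$ replaced by the arcs $uv$ and $vu$). An arc $uv$ of $D$ is symmetric if $vu$ is also an arc of $D$, and asymmetric otherwise. For an arc-colouring of a strongly connected digraph $D$, a directed path is rainbow if no two of its arcs have the same colour. $rc^*(D)$ is the minimum number of colours in an arc-colouring such that for every ordered pair of distinct vertices $x,y$ there is a rainbow directed $xy$-path. $src^*(D)$ is the minimum number of colours in an arc-colouring such that for every ordered pair of distinct vertices $x,y$ there is a rainbow directed $xy$-path of length equal to the directed distance $d_D(x,y)$. -}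

module Defs where

open import Data.Nat using (ℕ; zero; suc; _<_; _≤_)
open import Data.Nat.DivMod using (_%_; m%n<n)
open import Data.Fin using (Fin; toℕ; fromℕ<)
open import Data.Bool using (Bool; true; false; _∧_; not; if_then_else_)
open import Data.List using (List; []; _∷_; map; length)
open import Data.Nat.ListAction using (sum)
open import Data.List.Relation.Unary.Unique.Propositional using (Unique)
open import Data.List.Base using (allFin)
open import Data.Product using (Σ; _×_; ∃)
open import Data.Sum using (_⊎_)
open import Relation.Binary.PropositionalEquality using (_≡_)
open import Relation.Nullary using (¬_)

-- successor of a vertex along the cycle C_n (vertices Fin n, i ↦ i+1 mod n)
next : ∀ {n} → Fin n → Fin n
next {suc m} i = fromℕ< (m%n<n (suc (toℕ i)) (suc m))

Digraph : ℕ → Set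
Digraph n = Fin n → Fin n → Bool

Arc : ∀ {n} → Digraph n → Fin n → Fin n → Set
Arc D u v = D u v ≡ true

SubdigraphOfBiorientedCycle : ∀ {n} → Digraph n → Set
SubdigraphOfBiorientedCycle D = ∀ u v → Arc D u v → (v ≡ next u) ⊎ (u ≡ next v)

data Walk {n} (D : Digraph n) : Fin n → Fin n → Set where
  []  : ∀ {x} → Walk D x x
  _∷_ : ∀ {x y z} → Arc D x y → Walk D y z → Walk D x z

vertices : ∀ {n} {D : Digraph n} {x y} → Walk D x y → List (Fin n)
vertices {x = x} []       = x ∷ []
vertices {x = x} (a ∷ w) = x ∷ vertices w

len : ∀ {n} {D : Digraph n} {x y} → Walk D x y → ℕ
len []      = 0
len (a ∷ w) = suc (len w)

IsPath : ∀ {n} {D : Digraph n} {x y} → Walk D x y → Set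
IsPath w = Unique (vertices w)

StronglyConnected : ∀ {n} → Digraph n → Set
StronglyConnected D = ∀ x y → ∃ λ (w : Walk D x y) → IsPath w

IsGeodesic : ∀ {n} {D : Digraph n} {x y} → Walk D x y → Set
IsGeodesic {D = D} {x} {y} w = ∀ (w' : Walk D x y) → len w ≤ len w'

Colouring : ∀ {n} → Digraph n → ℕ → Set
Colouring {n} D c = (u v : Fin n) → Arc D u v → Fin c

colours : ∀ {n} {D : Digraph n} {c} → Colouring D c → ∀ {x y} → Walk D x y → List (Fin c)
colours col []                   = []
colours col (_∷_ {x} {y} a w) = col x y a ∷ colours col w

Rainbow : ∀ {n} {D : Digraph n} {c} → Colouring D c → ∀ {x y} → Walk D x y → Set
Rainbow col w = Unique (colours col w)

RainbowConnected : ∀ {n} {D : Digraph n} {c} → Colouring D c → Set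
RainbowConnected {n} {D} col = ∀ (x y : Fin n) → ¬ (x ≡ y) →
  ∃ λ (w : Walk D x y) → IsPath w × Rainbow col w

StronglyRainbowConnected : ∀ {n} {D : Digraph n} {c} → Colouring D c → Set
StronglyRainbowConnected {n} {D} col = ∀ (x y : Fin n) → ¬ (x ≡ y) →
  ∃ λ (w : Walk D x y) → IsPath w × IsGeodesic w × Rainbow col w

IsMinimum : (ℕ → Set) → ℕ → Set
IsMinimum P m = P m × (∀ j → j < m → ¬ P j)

rc*≡ : ∀ {n} → Digraph n → ℕ → Set
rc*≡ D = IsMinimum (λ c → ∃ λ (col : Colouring D c) → RainbowConnected col)

src*≡ : ∀ {n} → Digraph n → ℕ → Set
src*≡ D = IsMinimum (λ c → ∃ λ (col : Colouring D c) → StronglyRainbowConnected col)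

asymArcCount : ∀ {n} → Digraph n → ℕ
asymArcCount {n} D =
  sum (map (λ u → sum (map (λ v → if D u v ∧ not (D v u) then 1 else 0) (allFin n))) (allFin n))

-- Orient the cycle by σ so that the given asymmetric arc is a → σ a, and let rank α u be the
-- position of u on the cycle read from σ α (α itself has rank m = n − 1).  If the arc σ α → α is
-- missing, rank α rises by at most one along any arc, so every path from σ α to α has length m
-- and is the σ-path through all vertices.  For α = a this gives rc* ≥ n − 1 and shows that all
-- σ-arcs are present, so the asymmetric arcs are the σ-arcs with missing reverse.  For each of
-- them, a rainbow colouring must give distinct colours to the other n − 1 σ-arcs; with n − 1
-- colours two σ-arcs share a colour, and every asymmetric arc must be one of these two, so k ≤ 2.
-- Conversely, one colour per edge of the cycle is a strong rainbow colouring, and when all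
-- asymmetric arcs lie at a and b, letting the edge at a reuse the colour of the edge at b leaves
-- n − 1 colours with a rainbow path between every pair.

module Submission where

open import Defs
open import Data.Nat using (ℕ; zero; suc; _+_; _∸_; _≤_; _<_; z≤n; s≤s; s≤s⁻¹)
open import Data.Nat using (_≤‴_; ≤‴-refl; ≤‴-step; _≤′_; ≤′-refl; ≤′-step)
open import Data.Nat.Properties
open import Relation.Binary.Definitions using (tri<; tri≈; tri>)
open import Data.Nat.Induction using (<-rec)
open import Data.Nat.ListAction using (sum)
open import Data.Nat.DivMod using (_%_; m<n⇒m%n≡m; n%n≡0)
open import Data.Fin as F using (Fin; toℕ)
open import Data.Fin.Properties as FP using (pigeonhole)
import Data.Bool
open import Data.Bool using (Bool; true; false; _∧_; not; if_then_else_)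
open import Data.List using (List; []; _∷_; map; length; lookup; allFin)
open import Data.List.Relation.Unary.All as All using (All; []; _∷_)
open import Data.List.Relation.Unary.Any using (here; there)
open import Data.List.Relation.Unary.All.Properties using (¬Any⇒All¬; map⁺)
open import Data.List.Relation.Unary.AllPairs using ([]; _∷_)
open import Data.List.Relation.Unary.Unique.Propositional using (Unique)
open import Data.List.Relation.Unary.Unique.Propositional.Properties using (allFin⁺)
open import Data.List.Membership.Propositional using (_∈_)
open import Data.List.Membership.Propositional.Properties using (∈-lookup; ∈-map⁺; ∈-allFin)
import Data.List.Membership.DecPropositional as DecMembership
open import Data.Product using (_×_; _,_; ∃; proj₁; proj₂)
import Data.Sum
open import Data.Sum using (_⊎_; inj₁; inj₂; [_,_]′)
open import Data.Empty using (⊥; ⊥-elim)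
open import Axiom.UniquenessOfIdentityProofs using (module Decidable⇒UIP)
open import Function using (id; _∘′_)
open import Data.Unit using (⊤; tt)
open import Relation.Binary.PropositionalEquality
open import Relation.Nullary using (¬_; Dec; yes; no; contradiction)
open import Relation.Nullary.Decidable using (_×-dec_; ¬?)
open import Algebra.Properties.CommutativeSemigroup +-commutativeSemigroup using (interchange)

module _ {A : Set} where

  lookup-≢ : ∀ {xs : List A} → Unique xs → ∀ {i j} → i F.< j → lookup xs i ≢ lookup xs j
  lookup-≢ {x ∷ xs} (x∉ ∷ _) {F.zero}  {F.suc j} _   = All.lookup x∉ (∈-lookup {xs = xs} j)
  lookup-≢ {x ∷ xs} (_ ∷ u)  {F.suc i} {F.suc j} i<j = lookup-≢ u (s≤s⁻¹ i<j)

  map-unique⇒injective : ∀ {B : Set} (f : A → B) {xs : List A} → Unique (map f xs) →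
    ∀ {u v} → u ∈ xs → v ∈ xs → f u ≡ f v → u ≡ v
  map-unique⇒injective f _          (here refl) (here refl) _  = refl
  map-unique⇒injective f (fx∉ ∷ _) (here refl) (there v∈)  eq = ⊥-elim (All.lookup fx∉ (∈-map⁺ f v∈) eq)
  map-unique⇒injective f (fx∉ ∷ _) (there u∈)  (here refl) eq = ⊥-elim (All.lookup fx∉ (∈-map⁺ f u∈) (sym eq))
  map-unique⇒injective f (_ ∷ u)   (there u∈)  (there v∈)  eq = map-unique⇒injective f u u∈ v∈ eq

  unique-map⁺ : ∀ {B : Set} {Q : A → Set} (f : A → B) → (∀ {x y} → Q x → Q y → f x ≡ f y → x ≡ y) →
    ∀ {xs} → All Q xs → Unique xs → Unique (map f xs)
  unique-map⁺ f inj []         []        = []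
  unique-map⁺ f inj (qx ∷ qxs) (x∉ ∷ u) =
    map⁺ (All.zipWith (λ (x≢y , qy) eq → x≢y (inj qx qy eq)) (x∉ , qxs)) ∷ unique-map⁺ f inj qxs u

  sum-map-mono : ∀ (f g : A → ℕ) (xs : List A) → (∀ x → f x ≤ g x) → sum (map f xs) ≤ sum (map g xs)
  sum-map-mono f g []       _ = z≤n
  sum-map-mono f g (x ∷ xs) h = +-mono-≤ (h x) (sum-map-mono f g xs h)

  sum-map-+ : ∀ (f g : A → ℕ) (xs : List A) →
    sum (map (λ x → f x + g x) xs) ≡ sum (map f xs) + sum (map g xs)
  sum-map-+ f g []       = refl
  sum-map-+ f g (x ∷ xs) =
    trans (cong (f x + g x +_) (sum-map-+ f g xs)) (interchange (f x) (g x) _ _)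

  sum-map-cong : ∀ {f g : A → ℕ} (xs : List A) → (∀ x → f x ≡ g x) → sum (map f xs) ≡ sum (map g xs)
  sum-map-cong []       _ = refl
  sum-map-cong (x ∷ xs) h = cong₂ _+_ (h x) (sum-map-cong xs h)

  sum-map-positive : ∀ (f : A → ℕ) (xs : List A) → 1 ≤ sum (map f xs) → ∃ λ x → 1 ≤ f x
  sum-map-positive f (x ∷ xs) h with f x in eq
  ... | suc _ = x , subst (1 ≤_) (sym eq) (s≤s z≤n)
  ... | zero  = sum-map-positive f xs h

  sum-map-zero : ∀ (f : A → ℕ) {xs : List A} → All (λ x → f x ≡ 0) xs → sum (map f xs) ≡ 0
  sum-map-zero f []         = refl
  sum-map-zero f (z ∷ zs)  = cong₂ _+_ z (sum-map-zero f zs)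

  sum-map-support : ∀ (f : A → ℕ) {t} → (∀ v → v ≢ t → f v ≡ 0) →
    ∀ {xs} → Unique xs → t ∈ xs → sum (map f xs) ≡ f t
  sum-map-support f off (x∉ ∷ _) (here refl) =
    trans (cong (f _ +_) (sum-map-zero f (All.map (λ x≢v → off _ (x≢v ∘′ sym)) x∉))) (+-identityʳ _)
  sum-map-support f off (x∉ ∷ u) (there t∈) =
    cong₂ _+_ (off _ (All.lookup x∉ t∈)) (sum-map-support f off u t∈)

unique-length : ∀ {k} {xs : List (Fin k)} → Unique xs → length xs ≤ k
unique-length {k} {xs} u with length xs ≤? k
... | yes ≤k = ≤k
... | no ≰k with i , j , i<j , eq ← pigeonhole (≰⇒> ≰k) (lookup xs) = contradiction eq (lookup-≢ u i<j)

module _ {k : ℕ} where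

  δ : Fin k → Fin k → ℕ
  δ t x with x F.≟ t
  ... | yes _ = 1
  ... | no _  = 0

  δ-self : ∀ t → δ t t ≡ 1
  δ-self t with t F.≟ t
  ... | yes _  = refl
  ... | no t≢t = contradiction refl t≢t

  δ-other : ∀ {t x} → x ≢ t → δ t x ≡ 0
  δ-other {t} {x} x≢t with x F.≟ t
  ... | yes x≡t = contradiction x≡t x≢t
  ... | no _    = refl

  sum-δ : ∀ t → sum (map (δ t) (allFin k)) ≡ 1
  sum-δ t = trans (sum-map-support (δ t) (λ _ → δ-other) (allFin⁺ k) (∈-allFin t)) (δ-self t)

  sum-allFin-≤2 : ∀ (f : Fin k → ℕ) i j → (∀ x → f x ≤ 1) → (∀ x → 1 ≤ f x → x ≡ i ⊎ x ≡ j) →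
    sum (map f (allFin k)) ≤ 2
  sum-allFin-≤2 f i j f≤1 supp = begin
    sum (map f all)                            ≤⟨ sum-map-mono f _ all pointwise ⟩
    sum (map (λ x → δ i x + δ j x) all)        ≡⟨ sum-map-+ (δ i) (δ j) all ⟩
    sum (map (δ i) all) + sum (map (δ j) all)  ≡⟨ cong₂ _+_ (sum-δ i) (sum-δ j) ⟩
    2                                          ∎
    where
    open ≤-Reasoning
    all = allFin k
    pointwise : ∀ x → f x ≤ δ i x + δ j x
    pointwise x = by-cases (x F.≟ i) (x F.≟ j)
      where
      by-cases : Dec (x ≡ i) → Dec (x ≡ j) → f x ≤ δ i x + δ j x
      by-cases (yes refl) _          = ≤-trans (f≤1 x) (subst (λ d → 1 ≤ d + δ j x) (sym (δ-self x)) (m≤m+n 1 _))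
      by-cases (no _)     (yes refl) = ≤-trans (f≤1 x) (subst (λ d → 1 ≤ δ i x + d) (sym (δ-self x)) (m≤n+m 1 _))
      by-cases (no x≢i)   (no x≢j)   = ≤-trans (s≤s⁻¹ (≰⇒> λ 1≤fx → [ x≢i , x≢j ]′ (supp x 1≤fx))) z≤n

  sum-allFin-≥3 : ∀ (f : Fin k → ℕ) {u v w} → u ≢ v → u ≢ w → v ≢ w →
    1 ≤ f u → 1 ≤ f v → 1 ≤ f w → 3 ≤ sum (map f (allFin k))
  sum-allFin-≥3 f {u} {v} {w} u≢v u≢w v≢w fu fv fw = begin
    3                                            ≡⟨ sum-δ³ ⟨
    sum (map (λ x → δ u x + δ v x + δ w x) all)  ≤⟨ sum-map-mono _ f all pointwise ⟩
    sum (map f all)                              ∎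
    where
    open ≤-Reasoning
    all = allFin k
    sum-δ³ : sum (map (λ x → δ u x + δ v x + δ w x) all) ≡ 3
    sum-δ³ = trans (sum-map-+ _ (δ w) all)
      (cong₂ _+_ (trans (sum-map-+ (δ u) (δ v) all) (cong₂ _+_ (sum-δ u) (sum-δ v))) (sum-δ w))
    pointwise : ∀ x → δ u x + δ v x + δ w x ≤ f x
    pointwise x = by-cases (x F.≟ u) (x F.≟ v) (x F.≟ w)
      where
      by-cases : Dec (x ≡ u) → Dec (x ≡ v) → Dec (x ≡ w) → δ u x + δ v x + δ w x ≤ f x
      by-cases (yes refl) (yes refl) _          = contradiction refl u≢v
      by-cases (yes refl) _          (yes refl) = contradiction refl u≢w
      by-cases _          (yes refl) (yes refl) = contradiction refl v≢w
      by-cases (yes refl) (no x≢v)   (no x≢w)   rewrite δ-self x | δ-other x≢v | δ-other x≢w = fu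
      by-cases (no x≢u)   (yes refl) (no x≢w)   rewrite δ-self x | δ-other x≢u | δ-other x≢w = fv
      by-cases (no x≢u)   (no x≢v)   (yes refl) rewrite δ-self x | δ-other x≢u | δ-other x≢v = fw
      by-cases (no x≢u)   (no x≢v)   (no x≢w)   rewrite δ-other x≢u | δ-other x≢v | δ-other x≢w = z≤n

-- Walks, paths and geodesics

Arc-irrelevant : ∀ {n} (D : Digraph n) {u v} (p q : Arc D u v) → p ≡ q
Arc-irrelevant D = Decidable⇒UIP.≡-irrelevant Data.Bool._≟_

module _ {n : ℕ} {D : Digraph n} where
  open DecMembership (F._≟_ {n}) using (_∈?_)

  length-vertices : ∀ {x y} (w : Walk D x y) → length (vertices w) ≡ suc (len w)
  length-vertices []      = refl
  length-vertices (_ ∷ w) = cong suc (length-vertices w)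

  length-colours : ∀ {c} (col : Colouring D c) {x y} (w : Walk D x y) → length (colours col w) ≡ len w
  length-colours col []      = refl
  length-colours col (_ ∷ w) = cong suc (length-colours col w)

  path-len< : ∀ {x y} (w : Walk D x y) → IsPath w → len w < n
  path-len< w p = subst (_≤ n) (length-vertices w) (unique-length p)

  rainbow-len≤ : ∀ {c} (col : Colouring D c) {x y} (w : Walk D x y) → Rainbow col w → len w ≤ c
  rainbow-len≤ col w r = subst (_≤ _) (length-colours col w) (unique-length r)

  strong⇒rainbowConnected : ∀ {c} {col : Colouring D c} → StronglyRainbowConnected col → RainbowConnected col
  strong⇒rainbowConnected src x y x≢y with w , p , _ , r ← src x y x≢y = w , p , r

  sources : ∀ {x y} → Walk D x y → List (Fin n)
  sources []            = []
  sources {x} (_ ∷ w) = x ∷ sources w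

  All-vertices-head : ∀ {P : Fin n → Set} {x y} (w : Walk D x y) → All P (vertices w) → P x
  All-vertices-head []      (p ∷ _) = p
  All-vertices-head (_ ∷ _) (p ∷ _) = p

  suffix : ∀ {x y z} (w : Walk D x y) → z ∈ vertices w → ∃ λ (w' : Walk D z y) → len w' ≤ len w
  suffix []      (here refl) = [] , ≤-refl
  suffix (e ∷ w) (here refl) = e ∷ w , ≤-refl
  suffix (_ ∷ w) (there z∈)  with w' , le ← suffix w z∈ = w' , m≤n⇒m≤1+n le

  path-or-shortcut : ∀ {x y} (w : Walk D x y) → IsPath w ⊎ ∃ λ (w' : Walk D x y) → len w' < len w
  path-or-shortcut [] = inj₁ ([] ∷ [])
  path-or-shortcut {x} (e ∷ w) with path-or-shortcut w
  ... | inj₂ (w' , lt) = inj₂ (e ∷ w' , s≤s lt)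
  ... | inj₁ p with x ∈? vertices w
  ...   | yes x∈ = inj₂ (proj₁ (suffix w x∈) , s≤s (proj₂ (suffix w x∈)))
  ...   | no x∉  = inj₁ (¬Any⇒All¬ (vertices w) x∉ ∷ p)

  geodesic⇒path : ∀ {x y} (w : Walk D x y) → IsGeodesic w → IsPath w
  geodesic⇒path w g with path-or-shortcut w
  ... | inj₁ p        = p
  ... | inj₂ (w' , lt) = contradiction (g w') (<⇒≱ lt)

  walkOfLength? : ∀ l x y → Dec (∃ λ (w : Walk D x y) → len w ≡ l)
  walkOfLength? zero x y with x F.≟ y
  ... | yes refl = yes ([] , refl)
  ... | no x≢y   = no λ { ([] , _) → x≢y refl ; (_ ∷ _ , ()) }
  walkOfLength? (suc l) x y with FP.any? (λ z → (D x z Data.Bool.≟ true) ×-dec walkOfLength? l z y)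
  ... | yes (z , e , w , eq) = yes (e ∷ w , cong suc eq)
  ... | no none = no λ { ([] , ()) ; (_∷_ {y = z} e w , eq) → none (z , e , w , suc-injective eq) }

  shortest : ∀ {x y} → Walk D x y → ∃ λ (w : Walk D x y) → IsGeodesic w
  shortest {x} {y} w₀ = <-rec Shortest step (len w₀) w₀ refl
    where
    Shortest : ℕ → Set
    Shortest l = ∀ (w : Walk D x y) → len w ≡ l → ∃ λ (w' : Walk D x y) → IsGeodesic w'
    step : ∀ l → (∀ {l'} → l' < l → Shortest l') → Shortest l
    step l shorter w refl with anyUpTo? (λ l' → walkOfLength? l' x y) (len w)
    ... | yes (l' , l'<l , w' , eq) = shorter l'<l w' eq
    ... | no none = w , λ w' → ≮⇒≥ λ lt → none (len w' , lt , w' , refl)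

  geodesic : ∀ {x y} → Walk D x y → ∃ λ (w : Walk D x y) → IsPath w × IsGeodesic w
  geodesic w₀ with w , g ← shortest w₀ = w , geodesic⇒path w g , g

-- Cyclic orders

-- rank α u counts the σ-steps from σ α to u: the vertices σ α, σ (σ α), …, α have ranks 0, 1, …, m.
record CyclicOrder (m : ℕ) : Set where
  field
    σ              : Fin (suc m) → Fin (suc m)
    rank           : Fin (suc m) → Fin (suc m) → ℕ
    rank-σ-self    : ∀ α → rank α (σ α) ≡ 0
    rank-self      : ∀ α → rank α α ≡ m
    rank-σ         : ∀ α {u} → u ≢ α → rank α (σ u) ≡ suc (rank α u)
    rank-≤         : ∀ α u → rank α u ≤ m
    rank-injective : ∀ α {u v} → rank α u ≡ rank α v → u ≡ v

module _ (m : ℕ) where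

  -- The number of +1 steps modulo m + 1 from a + 1 to u, for a, u ≤ m.
  stepsAfter : ℕ → ℕ → ℕ
  stepsAfter a u with a <? u
  ... | yes _ = u ∸ suc a
  ... | no _  = u + m ∸ a

  stepsAfter-self : ∀ a → stepsAfter a a ≡ m
  stepsAfter-self a with a <? a
  ... | yes a<a = contradiction a<a (<-irrefl refl)
  ... | no _    = m+n∸m≡n a m

  stepsAfter-suc : ∀ {a u} → a ≤ m → u ≢ a → stepsAfter a (suc u) ≡ suc (stepsAfter a u)
  stepsAfter-suc {a} {u} a≤m u≢a with a <? u | a <? suc u
  ... | yes a<u | yes _     = +-∸-assoc 1 a<u
  ... | yes a<u | no a≮1+u  = contradiction (m<n⇒m<1+n a<u) a≮1+u
  ... | no a≮u  | yes a<1+u = contradiction (≤-antisym (≮⇒≥ a≮u) (s≤s⁻¹ a<1+u)) u≢a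
  ... | no _    | no _      = +-∸-assoc 1 (≤-trans a≤m (m≤n+m m u))

  stepsAfter-wrap : ∀ {a} → a < m → stepsAfter a 0 ≡ suc (stepsAfter a m)
  stepsAfter-wrap {a} a<m with a <? 0 | a <? m
  ... | no _ | no a≮m = contradiction a<m a≮m
  ... | no _ | yes _  = +-∸-assoc 1 a<m

  stepsAfter-suc-self : ∀ {a} → a < m → stepsAfter a (suc a) ≡ 0
  stepsAfter-suc-self {a} _ with a <? suc a
  ... | yes _     = n∸n≡0 a
  ... | no a≮1+a = contradiction ≤-refl a≮1+a

  stepsAfter-m-0 : stepsAfter m 0 ≡ 0
  stepsAfter-m-0 with m <? 0
  ... | no _ = n∸n≡0 m

  stepsAfter-≤ : ∀ a {u} → u ≤ m → stepsAfter a u ≤ m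
  stepsAfter-≤ a {u} u≤m with a <? u
  ... | yes _   = ≤-trans (m∸n≤m u (suc a)) u≤m
  ... | no a≮u = ≤-trans (∸-monoˡ-≤ a (+-monoˡ-≤ m (≮⇒≥ a≮u))) (≤-reflexive (m+n∸m≡n a m))

  stepsAfter-ahead<behind : ∀ {a u} v → a < u → u ≤ m → u ∸ suc a < v + m ∸ a
  stepsAfter-ahead<behind {a} {u} v a<u u≤m = begin-strict
    u ∸ suc a       ≤⟨ ∸-monoˡ-≤ (suc a) u≤m ⟩
    m ∸ suc a       <⟨ ≤-reflexive (sym (+-∸-assoc 1 (<-≤-trans a<u u≤m))) ⟩
    suc m ∸ suc a   ≤⟨ ∸-monoˡ-≤ a (m≤n+m m v) ⟩
    v + m ∸ a       ∎
    where open ≤-Reasoning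

  stepsAfter-injective : ∀ {a u v} → a ≤ m → u ≤ m → v ≤ m → stepsAfter a u ≡ stepsAfter a v → u ≡ v
  stepsAfter-injective {a} {u} {v} a≤m u≤m v≤m eq with a <? u | a <? v
  ... | yes a<u | yes a<v = ∸-cancelʳ-≡ a<u a<v eq
  ... | no _    | no _    =
    +-cancelʳ-≡ m u v (∸-cancelʳ-≡ (≤-trans a≤m (m≤n+m m u)) (≤-trans a≤m (m≤n+m m v)) eq)
  ... | yes a<u | no _    = contradiction eq (<⇒≢ (stepsAfter-ahead<behind v a<u u≤m))
  ... | no _    | yes a<v = contradiction (sym eq) (<⇒≢ (stepsAfter-ahead<behind u a<v v≤m))

opposite-injective : ∀ {k} {x y : Fin k} → F.opposite x ≡ F.opposite y → x ≡ y
opposite-injective {x = x} {y} eq =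
  trans (sym (FP.opposite-involutive x)) (trans (cong F.opposite eq) (FP.opposite-involutive y))

module _ {m : ℕ} where

  toℕ≤m : (i : Fin (suc m)) → toℕ i ≤ m
  toℕ≤m i = s≤s⁻¹ (FP.toℕ<n i)

  toℕ-next-< : ∀ (i : Fin (suc m)) → toℕ i < m → toℕ (next i) ≡ suc (toℕ i)
  toℕ-next-< i i<m = trans (FP.toℕ-fromℕ< _) (m<n⇒m%n≡m (s≤s i<m))

  toℕ-next-last : ∀ (i : Fin (suc m)) → toℕ i ≡ m → toℕ (next i) ≡ 0
  toℕ-next-last i i≡m =
    trans (FP.toℕ-fromℕ< _) (trans (cong (λ k → suc k % suc m) i≡m) (n%n≡0 (suc m)))

  prev : Fin (suc m) → Fin (suc m)
  prev x = F.opposite (next (F.opposite x))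

  next-opposite-next : ∀ u → next (F.opposite (next u)) ≡ F.opposite u
  next-opposite-next u with m≤n⇒m<n∨m≡n (toℕ≤m u)
  ... | inj₁ u<m = FP.toℕ-injective (begin
    toℕ (next (F.opposite (next u)))   ≡⟨ toℕ-next-< _ (subst (_< m) (sym opp-next) (∸-monoʳ-< (s≤s z≤n) u<m)) ⟩
    suc (toℕ (F.opposite (next u)))    ≡⟨ cong suc opp-next ⟩
    suc (m ∸ suc (toℕ u))              ≡⟨ +-∸-assoc 1 u<m ⟨
    m ∸ toℕ u                          ≡⟨ FP.opposite-prop u ⟨
    toℕ (F.opposite u)                 ∎)
    where
    open ≡-Reasoning
    opp-next : toℕ (F.opposite (next u)) ≡ m ∸ suc (toℕ u)
    opp-next = trans (FP.opposite-prop (next u)) (cong (m ∸_) (toℕ-next-< u u<m))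
  ... | inj₂ u≡m = FP.toℕ-injective (trans
    (toℕ-next-last _ (trans (FP.opposite-prop (next u)) (cong (m ∸_) (toℕ-next-last u u≡m))))
    (sym (trans (FP.opposite-prop u) (trans (cong (m ∸_) u≡m) (n∸n≡0 m)))))

  prev-next : ∀ u → prev (next u) ≡ u
  prev-next u = trans (cong F.opposite (next-opposite-next u)) (FP.opposite-involutive u)

clockwise : ∀ m → CyclicOrder m
clockwise m = record
  { σ              = next
  ; rank           = rank
  ; rank-σ-self    = rank-next-self
  ; rank-self      = λ α → stepsAfter-self m (toℕ α)
  ; rank-σ         = rank-next
  ; rank-≤         = λ α u → stepsAfter-≤ m (toℕ α) (toℕ≤m u)
  ; rank-injective = λ α eq → FP.toℕ-injective (stepsAfter-injective m (toℕ≤m α) (toℕ≤m _) (toℕ≤m _) eq)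
  }
  where
  rank : Fin (suc m) → Fin (suc m) → ℕ
  rank α x = stepsAfter m (toℕ α) (toℕ x)

  rank-next-self : ∀ α → rank α (next α) ≡ 0
  rank-next-self α with m≤n⇒m<n∨m≡n (toℕ≤m α)
  ... | inj₁ α<m = trans (cong (stepsAfter m (toℕ α)) (toℕ-next-< α α<m)) (stepsAfter-suc-self m α<m)
  ... | inj₂ α≡m = trans (cong₂ (stepsAfter m) α≡m (toℕ-next-last α α≡m)) (stepsAfter-m-0 m)

  rank-next : ∀ α {u} → u ≢ α → rank α (next u) ≡ suc (rank α u)
  rank-next α {u} u≢α with m≤n⇒m<n∨m≡n (toℕ≤m u)
  ... | inj₁ u<m = trans (cong (stepsAfter m (toℕ α)) (toℕ-next-< u u<m))
                         (stepsAfter-suc m (toℕ≤m α) (u≢α ∘′ FP.toℕ-injective))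
  ... | inj₂ u≡m = trans (cong (stepsAfter m (toℕ α)) (toℕ-next-last u u≡m))
                         (trans (stepsAfter-wrap m α<m) (cong (suc ∘′ stepsAfter m (toℕ α)) (sym u≡m)))
    where
    α<m : toℕ α < m
    α<m = ≤∧≢⇒< (toℕ≤m α) (λ α≡m → u≢α (FP.toℕ-injective (trans u≡m (sym α≡m))))

anticlockwise : ∀ m → CyclicOrder m
anticlockwise m = record
  { σ              = prev
  ; rank           = λ α x → rank (F.opposite α) (F.opposite x)
  ; rank-σ-self    = λ α → trans (cong (rank (F.opposite α)) (FP.opposite-involutive (next (F.opposite α))))
                                  (rank-σ-self (F.opposite α))
  ; rank-self      = λ α → rank-self (F.opposite α)
  ; rank-σ         = λ α {u} u≢α → trans (cong (rank (F.opposite α)) (FP.opposite-involutive (next (F.opposite u))))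
                                     (rank-σ (F.opposite α) (u≢α ∘′ opposite-injective))
  ; rank-≤         = λ α u → rank-≤ (F.opposite α) (F.opposite u)
  ; rank-injective = λ α eq → opposite-injective (rank-injective (F.opposite α) eq)
  }
  where open CyclicOrder (clockwise m)

-- Spanning subdigraphs of the bioriented cycle

ArcsAlong : ∀ {m} → CyclicOrder m → Digraph (suc m) → Set
ArcsAlong O D = ∀ u v → Arc D u v → v ≡ σ u ⊎ u ≡ σ v
  where open CyclicOrder O

module CycleDigraph {m : ℕ} (2≤m : 2 ≤ m) (O : CyclicOrder m) (D : Digraph (suc m))
                    (along : ArcsAlong O D) where
  open CyclicOrder O

  N : ℕ
  N = suc m

  rank<m : ∀ α {u} → u ≢ α → rank α u < m
  rank<m α u≢α = ≤∧≢⇒< (rank-≤ α _) (λ eq → u≢α (rank-injective α (trans eq (sym (rank-self α)))))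

  σ-irreflexive : ∀ u → σ u ≢ u
  σ-irreflexive u eq = <⇒≢ (≤-trans (s≤s z≤n) 2≤m)
    (trans (sym (rank-σ-self u)) (trans (cong (rank u) eq) (rank-self u)))

  σ²-irreflexive : ∀ u → σ (σ u) ≢ u
  σ²-irreflexive u eq = <⇒≢ 2≤m (sym (begin
    m                    ≡⟨ rank-self u ⟨
    rank u u             ≡⟨ cong (rank u) eq ⟨
    rank u (σ (σ u))     ≡⟨ rank-σ u (σ-irreflexive u) ⟩
    suc (rank u (σ u))   ≡⟨ cong suc (rank-σ-self u) ⟩
    1                    ∎))
    where open ≡-Reasoning

  -- Since the arc σ α → α is missing, rank α rises by at most one along an arc, and by exactly
  -- one only along σ-arcs; so a walk from x to α has length at least m ∸ rank α x, and a walk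
  -- attaining this bound (a tight walk) follows σ through every vertex of rank ≥ rank α x.
  module Anchored (α : Fin N) (α-asym : D (σ α) α ≡ false) where

    rank-arc : ∀ {x y} → Arc D x y → rank α y ≤ suc (rank α x)
    rank-arc {x} e with along x _ e
    ... | inj₁ refl with x F.≟ α
    ...   | yes refl = subst (_≤ suc (rank α α)) (sym (rank-σ-self α)) z≤n
    ...   | no x≢α   = ≤-reflexive (rank-σ α x≢α)
    rank-arc {y = y} e | inj₂ refl with y F.≟ α
    ...   | yes refl = contradiction (trans (sym e) α-asym) λ ()
    ...   | no y≢α   = ≤-trans (m≤n+m _ 2) (≤-reflexive (cong suc (sym (rank-σ α y≢α))))

    walk-length-≥ : ∀ {x} (w : Walk D x α) → m ≤ rank α x + len w
    walk-length-≥ []  = ≤-reflexive (sym (trans (+-identityʳ _) (rank-self α)))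
    walk-length-≥ {x} (_∷_ {y = y} e w) = begin
      m                           ≤⟨ walk-length-≥ w ⟩
      rank α y + len w            ≤⟨ +-monoˡ-≤ (len w) (rank-arc e) ⟩
      suc (rank α x) + len w      ≡⟨ +-suc (rank α x) (len w) ⟨
      rank α x + suc (len w)      ∎
      where open ≤-Reasoning

    Tight : ∀ {x} → Walk D x α → Set
    Tight {x} w = rank α x + len w ≤ m

    path-tight : (w : Walk D (σ α) α) → IsPath w → Tight w
    path-tight w p = subst (λ r → r + len w ≤ m) (sym (rank-σ-self α)) (s≤s⁻¹ (path-len< w p))

    tight-head : ∀ {x y} (e : Arc D x y) (w : Walk D y α) → Tight (e ∷ w) → y ≡ σ x × x ≢ α × Tight w
    tight-head {x} {y} e w t with along x y e
    ... | inj₁ refl = refl , x≢α , subst (λ r → r + len w ≤ m) (sym rank-y) (subst (_≤ m) (+-suc _ _) t)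
      where
      rank-y : rank α y ≡ suc (rank α x)
      rank-y = ≤-antisym (rank-arc e) (+-cancelʳ-≤ (len w) _ _
                 (≤-trans (≤-reflexive (sym (+-suc (rank α x) (len w)))) (≤-trans t (walk-length-≥ w))))
      x≢α : x ≢ α
      x≢α refl = 0≢1+n (trans (sym (rank-σ-self α)) rank-y)
    ... | inj₂ refl with y F.≟ α
    ...   | yes refl = contradiction (trans (sym e) α-asym) λ ()
    ...   | no y≢α   = contradiction (≤-trans t (walk-length-≥ w)) (<⇒≱ (begin-strict
      rank α y + len w             <⟨ +-monoˡ-< (len w) (n<1+n _) ⟩
      suc (rank α y) + len w       ≡⟨ cong (_+ len w) (rank-σ α y≢α) ⟨
      rank α (σ y) + len w         <⟨ +-monoʳ-< (rank α (σ y)) (n<1+n (len w)) ⟩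
      rank α (σ y) + suc (len w)   ∎))
      where open ≤-Reasoning

    rank-σ-self-≤ : ∀ u → rank α (σ α) ≤ rank α u
    rank-σ-self-≤ u = subst (_≤ rank α u) (sym (rank-σ-self α)) z≤n

    rank-≤-σ : ∀ {x u} → x ≢ α → rank α x ≤ rank α u → u ≢ x → rank α (σ x) ≤ rank α u
    rank-≤-σ {u = u} x≢α le u≢x =
      subst (_≤ rank α u) (sym (rank-σ α x≢α)) (≤∧≢⇒< le (λ eq → u≢x (rank-injective α (sym eq))))

    rank-self-≰ : ∀ {u} → rank α α ≤ rank α u → rank α u < m → ⊥
    rank-self-≰ le lt = <-irrefl refl (<-≤-trans lt (subst (_≤ _) (rank-self α) le))

    tight-arc : ∀ {x} (w : Walk D x α) → Tight w →
      ∀ u → rank α x ≤ rank α u → rank α u < m → Arc D u (σ u)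
    tight-arc [] _ u le lt = ⊥-elim (rank-self-≰ le lt)
    tight-arc {x} (e ∷ w) t u le lt with tight-head e w t | u F.≟ x
    ... | refl , _   , _  | yes refl = e
    ... | refl , x≢α , t' | no u≢x   = tight-arc w t' u (rank-≤-σ x≢α le u≢x) lt

    tight-source : ∀ {x} (w : Walk D x α) → Tight w →
      ∀ u → rank α x ≤ rank α u → rank α u < m → u ∈ sources w
    tight-source [] _ u le lt = ⊥-elim (rank-self-≰ le lt)
    tight-source {x} (e ∷ w) t u le lt with tight-head e w t | u F.≟ x
    ... | refl , _   , _  | yes refl = here refl
    ... | refl , x≢α , t' | no u≢x   = there (tight-source w t' u (rank-≤-σ x≢α le u≢x) lt)

    tight-colours : (fwd : ∀ u → Arc D u (σ u)) {c : ℕ} (col : Colouring D c) →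
      ∀ {x} (w : Walk D x α) → Tight w → colours col w ≡ map (λ u → col u (σ u) (fwd u)) (sources w)
    tight-colours fwd col []             _ = refl
    tight-colours fwd col {x} (e ∷ w) t with tight-head e w t
    ... | refl , _ , t' = cong₂ _∷_ (cong (col x (σ x)) (Arc-irrelevant D e (fwd x))) (tight-colours fwd col w t')

  -- The cycle edge {e , σ e} carrying an arc u → v, named by e.
  edge : Fin N → Fin N → Fin N
  edge u v with v F.≟ σ u
  ... | yes _ = u
  ... | no _  = v

  edge-σ : ∀ u → edge u (σ u) ≡ u
  edge-σ u with σ u F.≟ σ u
  ... | yes _   = refl
  ... | no σu≢σu = contradiction refl σu≢σu

  edge-σ⁻¹ : ∀ v → edge (σ v) v ≡ v
  edge-σ⁻¹ v with v F.≟ σ (σ v)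
  ... | yes v≡σ²v = contradiction (sym v≡σ²v) (σ²-irreflexive v)
  ... | no _      = refl

  edge-cases : ∀ {u v} → Arc D u v → (edge u v ≡ u × v ≡ σ u) ⊎ (edge u v ≡ v × u ≡ σ v)
  edge-cases {u} {v} e with v F.≟ σ u
  ... | yes v≡σu = inj₁ (refl , v≡σu)
  ... | no v≢σu  with along u v e
  ...   | inj₁ v≡σu = contradiction v≡σu v≢σu
  ...   | inj₂ u≡σv = inj₂ (refl , u≡σv)

  edge-match : ∀ {x y u v} → Arc D x y → Arc D u v → edge x y ≡ edge u v → x ≡ u ⊎ x ≡ v
  edge-match e₁ e₂ eq with edge-cases e₁ | edge-cases e₂
  ... | inj₁ (p₁ , _)  | inj₁ (p₂ , _)  = inj₁ (trans (sym p₁) (trans eq p₂))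
  ... | inj₁ (p₁ , _)  | inj₂ (p₂ , _)  = inj₂ (trans (sym p₁) (trans eq p₂))
  ... | inj₂ (p₁ , q₁) | inj₁ (p₂ , q₂) = inj₂ (trans q₁ (trans (cong σ (trans (sym p₁) (trans eq p₂))) (sym q₂)))
  ... | inj₂ (p₁ , q₁) | inj₂ (p₂ , q₂) = inj₁ (trans q₁ (trans (cong σ (trans (sym p₁) (trans eq p₂))) (sym q₂)))

  edges : ∀ {x y} → Walk D x y → List (Fin N)
  edges []                  = []
  edges (_∷_ {x} {y} _ w) = edge x y ∷ edges w

  edge-∉ : ∀ {x y} (e : Arc D x y) {y' z} (w : Walk D y' z) →
    All (x ≢_) (vertices w) → All (edge x y ≢_) (edges w)
  edge-∉ e []       _          = []
  edge-∉ e (e' ∷ w) (x≢u ∷ x∉) =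
    (λ eq → [ x≢u , All-vertices-head w x∉ ]′ (edge-match e e' eq)) ∷ edge-∉ e w x∉

  path-edges-unique : ∀ {x y} (w : Walk D x y) → IsPath w → Unique (edges w)
  path-edges-unique []      _          = []
  path-edges-unique (e ∷ w) (x∉ ∷ p) = edge-∉ e w x∉ ∷ path-edges-unique w p

  edgeColouring : ∀ {c} → (Fin N → Fin c) → Colouring D c
  edgeColouring g u v _ = g (edge u v)

  colours-edgeColouring : ∀ {c} (g : Fin N → Fin c) {x y} (w : Walk D x y) →
    colours (edgeColouring g) w ≡ map g (edges w)
  colours-edgeColouring g []      = refl
  colours-edgeColouring g (_ ∷ w) = cong (_ ∷_) (colours-edgeColouring g w)

  path-rainbow : ∀ {c} (g : Fin N → Fin c) {Q : Fin N → Set} → (∀ {s t} → Q s → Q t → g s ≡ g t → s ≡ t) →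
    ∀ {x y} (w : Walk D x y) → IsPath w → All Q (edges w) → Rainbow (edgeColouring g) w
  path-rainbow g inj w p q =
    subst Unique (sym (colours-edgeColouring g w)) (unique-map⁺ g inj q (path-edges-unique w p))

  absent : Bool → ℕ
  absent true  = 0
  absent false = 1

  absent≤1 : ∀ b → absent b ≤ 1
  absent≤1 true  = z≤n
  absent≤1 false = ≤-refl

  1≤absent : ∀ {b} → 1 ≤ absent b → b ≡ false
  1≤absent {false} _ = refl

  module _ (sc : StronglyConnected D) (a : Fin N) (a-arc : Arc D a (σ a)) (a-asym : D (σ a) a ≡ false) where

    forward-arc : ∀ u → Arc D u (σ u)
    forward-arc u with u F.≟ a
    ... | yes refl = a-arc
    ... | no u≢a   with w , p ← sc (σ a) a =
      tight-arc w (path-tight w p) u (rank-σ-self-≤ u) (rank<m a u≢a)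
      where open Anchored a a-asym

    -- With every σ-arc present, the asymmetric arcs are the σ-arcs u → σ u whose reverse is missing.
    asymArcCount≡ : asymArcCount D ≡ sum (map (λ u → absent (D (σ u) u)) (allFin N))
    asymArcCount≡ = sum-map-cong (allFin N) λ u →
      trans (sum-map-support _ (off-σ u) (allFin⁺ N) (∈-allFin (σ u))) (at-σ u)
      where
      off-σ : ∀ u v → v ≢ σ u → (if D u v ∧ not (D v u) then 1 else 0) ≡ 0
      off-σ u v v≢σu with D u v in e
      ... | false = refl
      ... | true  with along u v e
      ...   | inj₁ v≡σu = contradiction v≡σu v≢σu
      ...   | inj₂ refl rewrite forward-arc v = refl
      at-σ : ∀ u → (if D u (σ u) ∧ not (D (σ u) u) then 1 else 0) ≡ absent (D (σ u) u)
      at-σ u rewrite forward-arc u with D (σ u) u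
      ... | true  = refl
      ... | false = refl

    asym⊆pair⇒count≤2 : ∀ i j → (∀ u → D (σ u) u ≡ false → u ≡ i ⊎ u ≡ j) → asymArcCount D ≤ 2
    asym⊆pair⇒count≤2 i j sub = subst (_≤ 2) (sym asymArcCount≡)
      (sum-allFin-≤2 _ i j (λ x → absent≤1 (D (σ x) x)) (λ x 1≤ → sub x (1≤absent 1≤)))

    three-asym⇒3≤count : ∀ {u v w} → u ≢ v → u ≢ w → v ≢ w →
      D (σ u) u ≡ false → D (σ v) v ≡ false → D (σ w) w ≡ false → 3 ≤ asymArcCount D
    three-asym⇒3≤count u≢v u≢w v≢w hu hv hw = subst (3 ≤_) (sym asymArcCount≡)
      (sum-allFin-≥3 _ u≢v u≢w v≢w (1≤ hu) (1≤ hv) (1≤ hw))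
      where
      1≤ : ∀ {b} → b ≡ false → 1 ≤ absent b
      1≤ refl = ≤-refl

    rainbow⇒m≤ : ∀ {c} (col : Colouring D c) → RainbowConnected col → m ≤ c
    rainbow⇒m≤ col rc with w , _ , r ← rc (σ a) a (σ-irreflexive a) =
      ≤-trans (subst (λ r → m ≤ r + len w) (rank-σ-self a) (walk-length-≥ w)) (rainbow-len≤ col w r)
      where open Anchored a a-asym

    forwardColour : ∀ {c} → Colouring D c → Fin N → Fin c
    forwardColour col u = col u (σ u) (forward-arc u)

    -- The rainbow path σ u → u is tight, so it runs forward through all vertices other than u,
    -- and its colours are their forward colours.
    rainbow⇒forwardColour-injective : ∀ {c} (col : Colouring D c) → RainbowConnected col →
      ∀ u → D (σ u) u ≡ false → ∀ {i j} → i ≢ u → j ≢ u → forwardColour col i ≡ forwardColour col j → i ≡ j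
    rainbow⇒forwardColour-injective col rc u u-asym {i} {j} i≢u j≢u same
      with w , p , r ← rc (σ u) u (σ-irreflexive u) =
      map-unique⇒injective (forwardColour col) (subst Unique (tight-colours forward-arc col w t) r)
        (tight-source w t i (rank-σ-self-≤ i) (rank<m u i≢u)) (tight-source w t j (rank-σ-self-≤ j) (rank<m u j≢u))
        same
      where
      open Anchored u u-asym
      t : Tight w
      t = path-tight w p

    rainbow-m⇒asym⊆pair : (col : Colouring D m) → RainbowConnected col →
      ∃ λ i → ∃ λ j → ∀ u → D (σ u) u ≡ false → u ≡ i ⊎ u ≡ j
    rainbow-m⇒asym⊆pair col rc with i , j , i<j , same ← pigeonhole (n<1+n m) (forwardColour col) =
      i , j , λ u u-asym → asym⊆ u u-asym (u F.≟ i) (u F.≟ j)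
      where
      asym⊆ : ∀ u → D (σ u) u ≡ false → Dec (u ≡ i) → Dec (u ≡ j) → u ≡ i ⊎ u ≡ j
      asym⊆ u _      (yes u≡i) _         = inj₁ u≡i
      asym⊆ u _      (no _)    (yes u≡j) = inj₂ u≡j
      asym⊆ u u-asym (no u≢i)  (no u≢j)  = contradiction
        (cong toℕ (rainbow⇒forwardColour-injective col rc u u-asym (u≢i ∘′ sym) (u≢j ∘′ sym) same))
        (<⇒≢ i<j)

    3≤count⇒rainbow⇒N≤ : 3 ≤ asymArcCount D → ∀ {c} (col : Colouring D c) → RainbowConnected col → N ≤ c
    3≤count⇒rainbow⇒N≤ 3≤count col rc with m≤n⇒m<n∨m≡n (rainbow⇒m≤ col rc)
    ... | inj₁ m<c  = m<c
    ... | inj₂ refl with i , j , asym⊆ ← rainbow-m⇒asym⊆pair col rc =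
      contradiction (≤-trans 3≤count (asym⊆pair⇒count≤2 i j asym⊆)) (<-irrefl refl)

    stronglyRainbowConnected-N : ∃ λ (col : Colouring D N) → StronglyRainbowConnected col
    stronglyRainbowConnected-N = edgeColouring id , λ x y _ →
      let w , p , g = geodesic (proj₁ (sc x y))
      in  w , p , g , path-rainbow id {Q = λ _ → ⊤} (λ _ _ eq → eq) w p (All.universal (λ _ → tt) _)

    -- Colour the edge e by rank a e < m, except that the edge a (of rank m) takes the colour of b.
    -- A path avoiding the edge a, or avoiding the edge b, is then rainbow.  Between the vertices of
    -- ranks i and j one goes forward along σ when i < j; when j < i one goes backward, unless that
    -- needs the missing arc at b (j ≤ rank a b < i), and then forward round through a instead.
    module TwoAsymmetric (b : Fin N) (b≢a : b ≢ a) (asym⊆ : ∀ u → D (σ u) u ≡ false → u ≡ a ⊎ u ≡ b) where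

      at : ℕ → Fin N
      at zero    = σ a
      at (suc t) = σ (at t)

      rank-at : ∀ {t} → t ≤ m → rank a (at t) ≡ t
      rank-at {zero}  _   = rank-σ-self a
      rank-at {suc t} t<m = trans (rank-σ a at-t≢a) (cong suc (rank-at (<⇒≤ t<m)))
        where
        at-t≢a : at t ≢ a
        at-t≢a eq = <⇒≢ t<m (trans (sym (rank-at (<⇒≤ t<m))) (trans (cong (rank a) eq) (rank-self a)))

      at-rank : ∀ u → at (rank a u) ≡ u
      at-rank u = rank-injective a (rank-at (rank-≤ a u))

      at-m : at m ≡ a
      at-m = rank-injective a (trans (rank-at ≤-refl) (sym (rank-self a)))

      at-injective : ∀ {s t} → s ≤ m → t ≤ m → at s ≡ at t → s ≡ t
      at-injective s≤m t≤m eq = trans (sym (rank-at s≤m)) (trans (cong (rank a) eq) (rank-at t≤m))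

      at-<-≢ : ∀ {s t} → s < t → t ≤ m → at s ≢ at t
      at-<-≢ s<t t≤m eq = <⇒≢ s<t (at-injective (≤-trans (<⇒≤ s<t) t≤m) t≤m eq)

      at≢a : ∀ {t} → t < m → at t ≢ a
      at≢a t<m eq = <⇒≢ t<m (at-injective (<⇒≤ t<m) ≤-refl (trans eq (sym at-m)))

      colourRank : Fin N → ℕ
      colourRank e with e F.≟ a
      ... | yes _ = rank a b
      ... | no _  = rank a e

      colourRank-≡a : ∀ {e} → e ≡ a → colourRank e ≡ rank a b
      colourRank-≡a {e} e≡a with e F.≟ a
      ... | yes _   = refl
      ... | no e≢a  = contradiction e≡a e≢a

      colourRank-≢a : ∀ {e} → e ≢ a → colourRank e ≡ rank a e
      colourRank-≢a {e} e≢a with e F.≟ a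
      ... | yes e≡a = contradiction e≡a e≢a
      ... | no _    = refl

      colourRank<m : ∀ e → colourRank e < m
      colourRank<m e with e F.≟ a
      ... | yes _   = rank<m a b≢a
      ... | no e≢a  = rank<m a e≢a

      colour : Fin N → Fin m
      colour e = F.fromℕ< (colourRank<m e)

      colourRank-injective : ∀ {s t} → colour s ≡ colour t → colourRank s ≡ colourRank t
      colourRank-injective {s} {t} eq =
        trans (sym (FP.toℕ-fromℕ< (colourRank<m s))) (trans (cong toℕ eq) (FP.toℕ-fromℕ< (colourRank<m t)))

      colour-injective-≢a : ∀ {s t} → s ≢ a → t ≢ a → colour s ≡ colour t → s ≡ t
      colour-injective-≢a {s} {t} s≢a t≢a eq =
        rank-injective a (trans (sym (colourRank-≢a {s} s≢a))
                           (trans (colourRank-injective {s} {t} eq) (colourRank-≢a {t} t≢a)))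

      colour-injective-≢b : ∀ {s t} → s ≢ b → t ≢ b → colour s ≡ colour t → s ≡ t
      colour-injective-≢b {s} {t} s≢b t≢b eq = by-cases (s F.≟ a) (t F.≟ a)
        where
        same-rank = colourRank-injective {s} {t} eq
        by-cases : Dec (s ≡ a) → Dec (t ≡ a) → s ≡ t
        by-cases (yes s≡a) (yes t≡a) = trans s≡a (sym t≡a)
        by-cases (yes s≡a) (no t≢a)  = contradiction
          (rank-injective a (trans (sym (colourRank-≢a {t} t≢a)) (trans (sym same-rank) (colourRank-≡a {s} s≡a)))) t≢b
        by-cases (no s≢a)  (yes t≡a) = contradiction
          (rank-injective a (trans (sym (colourRank-≢a {s} s≢a)) (trans same-rank (colourRank-≡a {t} t≡a)))) s≢b
        by-cases (no s≢a)  (no t≢a)  = colour-injective-≢a s≢a t≢a eq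

      forward : ∀ {z} i j → i ≤‴ j → Walk D (at j) z → Walk D (at i) z
      forward i .i ≤‴-refl         k = k
      forward i j  (≤‴-step i<‴j) k = forward-arc (at i) ∷ forward (suc i) j i<‴j k

      forward-vertices : ∀ {z} {R : Fin N → Set} i j (i≤‴j : i ≤‴ j) (k : Walk D (at j) z) →
        (∀ t → i ≤ t → t < j → R (at t)) → All R (vertices k) → All R (vertices (forward i j i≤‴j k))
      forward-vertices i .i ≤‴-refl         k _   rk = rk
      forward-vertices i j  (≤‴-step i<‴j) k inRange rk =
        inRange i ≤-refl (≤‴⇒≤ i<‴j) ∷ forward-vertices (suc i) j i<‴j k (λ t i<t → inRange t (<⇒≤ i<t)) rk

      forward-edges : ∀ {z} {Q : Fin N → Set} i j (i≤‴j : i ≤‴ j) (k : Walk D (at j) z) →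
        (∀ t → i ≤ t → t < j → Q (at t)) → All Q (edges k) → All Q (edges (forward i j i≤‴j k))
      forward-edges i .i ≤‴-refl                   k _   qk = qk
      forward-edges {Q = Q} i j (≤‴-step i<‴j) k inRange qk =
        subst Q (sym (edge-σ (at i))) (inRange i ≤-refl (≤‴⇒≤ i<‴j))
        ∷ forward-edges (suc i) j i<‴j k (λ t i<t → inRange t (<⇒≤ i<t)) qk

      forward-path : ∀ {z} i j (i≤‴j : i ≤‴ j) (k : Walk D (at j) z) → j ≤ m → IsPath k →
        All (λ v → rank a v < i ⊎ j ≤ rank a v) (vertices k) → IsPath (forward i j i≤‴j k)
      forward-path i .i ≤‴-refl         k _   pk _       = pk
      forward-path i j  (≤‴-step i<‴j) k j≤m pk outside =
        forward-vertices (suc i) j i<‴j k (λ t i<t t<j → at-<-≢ i<t (≤-trans (<⇒≤ t<j) j≤m))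
          (All.map at-i∉ outside)
        ∷ forward-path (suc i) j i<‴j k j≤m pk (All.map (Data.Sum.map₁ m<n⇒m<1+n) outside)
        where
        i≤m : i ≤ m
        i≤m = ≤-trans (n≤1+n i) (≤-trans (≤‴⇒≤ i<‴j) j≤m)
        at-i∉ : ∀ {v} → rank a v < i ⊎ j ≤ rank a v → at i ≢ v
        at-i∉ (inj₁ v<i) refl = <-irrefl (rank-at i≤m) v<i
        at-i∉ (inj₂ j≤v) refl = <-irrefl refl (≤-trans (≤‴⇒≤ i<‴j) (subst (j ≤_) (rank-at i≤m) j≤v))

      backward : ∀ {i j} → j ≤′ i → (∀ t → j ≤ t → t < i → Arc D (σ (at t)) (at t)) → Walk D (at i) (at j)
      backward                 ≤′-refl         _    = []
      backward {suc i} {j} (≤′-step j≤′i) arcs =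
        arcs i (≤′⇒≤ j≤′i) ≤-refl ∷ backward j≤′i (λ t j≤t t<i → arcs t j≤t (m<n⇒m<1+n t<i))

      backward-vertices : ∀ {R : Fin N → Set} {i j} (j≤′i : j ≤′ i) arcs →
        (∀ t → j ≤ t → t ≤ i → R (at t)) → All R (vertices (backward j≤′i arcs))
      backward-vertices {j = j} ≤′-refl _ inRange = inRange j ≤-refl ≤-refl ∷ []
      backward-vertices {i = suc i} (≤′-step j≤′i) arcs inRange =
        inRange (suc i) (m≤n⇒m≤1+n (≤′⇒≤ j≤′i)) ≤-refl
        ∷ backward-vertices j≤′i _ (λ t j≤t t≤i → inRange t j≤t (m≤n⇒m≤1+n t≤i))

      backward-edges : ∀ {Q : Fin N → Set} {i j} (j≤′i : j ≤′ i) arcs →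
        (∀ t → j ≤ t → t < i → Q (at t)) → All Q (edges (backward j≤′i arcs))
      backward-edges ≤′-refl _ _ = []
      backward-edges {Q} {suc i} (≤′-step j≤′i) arcs inRange =
        subst Q (sym (edge-σ⁻¹ (at i))) (inRange i (≤′⇒≤ j≤′i) ≤-refl)
        ∷ backward-edges j≤′i _ (λ t j≤t t<i → inRange t j≤t (m<n⇒m<1+n t<i))

      backward-path : ∀ {i j} (j≤′i : j ≤′ i) arcs → i ≤ m → IsPath (backward j≤′i arcs)
      backward-path ≤′-refl _ _ = [] ∷ []
      backward-path {suc i} (≤′-step j≤′i) arcs 1+i≤m =
        backward-vertices j≤′i _ (λ t _ t≤i → at-<-≢ (s≤s t≤i) 1+i≤m ∘′ sym)
        ∷ backward-path j≤′i _ i≤m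
        where
        i≤m : i ≤ m
        i≤m = ≤-trans (n≤1+n i) 1+i≤m

      RainbowPath : Fin N → Fin N → Set
      RainbowPath x y = ∃ λ (w : Walk D x y) → IsPath w × Rainbow (edgeColouring colour) w

      at-≢b : ∀ {t} → t ≤ m → t ≢ rank a b → at t ≢ b
      at-≢b t≤m t≢b eq = t≢b (trans (sym (rank-at t≤m)) (cong (rank a) eq))

      forward-route : ∀ {i j} → i < j → j ≤ m → RainbowPath (at i) (at j)
      forward-route {i} {j} i<j j≤m =
        w , path , path-rainbow colour colour-injective-≢a w path
                     (forward-edges i j _ [] (λ t _ t<j → at≢a (<-≤-trans t<j j≤m)) [])
        where
        w    = forward i j (≤⇒≤‴ (<⇒≤ i<j)) []
        path = forward-path i j _ [] j≤m ([] ∷ []) (inj₂ (≤-reflexive (sym (rank-at j≤m))) ∷ [])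

      backward-route : ∀ {i j} → j < i → i ≤ m → ¬ (j ≤ rank a b × rank a b < i) → RainbowPath (at i) (at j)
      backward-route {i} {j} j<i i≤m b-outside =
        w , path , path-rainbow colour colour-injective-≢a w path
                     (backward-edges j≤′i arcs (λ t _ t<i → at≢a (<-≤-trans t<i i≤m)))
        where
        j≤′i = ≤⇒≤′ (<⇒≤ j<i)
        arcs : ∀ t → j ≤ t → t < i → Arc D (σ (at t)) (at t)
        arcs t j≤t t<i with D (σ (at t)) (at t) in e
        ... | true  = refl
        ... | false with asym⊆ (at t) e
        ...   | inj₁ at-t≡a = contradiction at-t≡a (at≢a (<-≤-trans t<i i≤m))
        ...   | inj₂ at-t≡b = contradiction (subst (j ≤_) t≡b j≤t , subst (_< i) t≡b t<i) b-outside
          where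
          t≡b : t ≡ rank a b
          t≡b = trans (sym (rank-at (≤-trans (<⇒≤ t<i) i≤m))) (cong (rank a) at-t≡b)
        w    = backward j≤′i arcs
        path = backward-path j≤′i arcs i≤m

      wrap-route : ∀ {i j} → j < i → i ≤ m → j ≤ rank a b → rank a b < i → RainbowPath (at i) (at j)
      wrap-route {i} {j} j<i i≤m j≤b b<i =
        w , path , path-rainbow colour colour-injective-≢b w path
                     (forward-edges i m _ k (λ t i≤t t<m → at-≢b (<⇒≤ t<m) (>⇒≢ (<-≤-trans b<i i≤t))) edges-k)
        where
        j<m : j < m
        j<m = <-≤-trans j<i i≤m
        round : Walk D (at 0) (at j)
        round = forward 0 j (≤⇒≤‴ z≤n) []
        round-vertices : ∀ {R : Fin N → Set} → (∀ t → t ≤ j → R (at t)) → All R (vertices round)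
        round-vertices r = forward-vertices 0 j _ [] (λ t _ t<j → r t (<⇒≤ t<j)) (r j ≤-refl ∷ [])
        wrap : Arc D (at m) (at 0)
        wrap = subst (λ v → Arc D (at m) v) (cong σ at-m) (forward-arc (at m))
        k : Walk D (at m) (at j)
        k = wrap ∷ round
        path-k : IsPath k
        path-k = round-vertices (λ t t≤j → at-<-≢ (≤-<-trans t≤j j<m) ≤-refl ∘′ sym)
                 ∷ forward-path 0 j _ [] (<⇒≤ j<m) ([] ∷ []) (inj₂ (≤-reflexive (sym (rank-at (<⇒≤ j<m)))) ∷ [])
        outside-k : All (λ v → rank a v < i ⊎ m ≤ rank a v) (vertices k)
        outside-k = inj₂ (≤-reflexive (sym (rank-at ≤-refl)))
                    ∷ round-vertices (λ t t≤j → inj₁ (subst (_< i) (sym (rank-at (≤-trans t≤j (<⇒≤ j<m)))) (≤-<-trans t≤j j<i)))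
        edges-k : All (_≢ b) (edges k)
        edges-k = (λ eq → b≢a (trans (sym eq) (trans (cong (λ u → edge u (σ a)) at-m) (edge-σ a))))
                  ∷ forward-edges 0 j _ [] (λ t _ t<j → at-≢b (<⇒≤ (<-trans t<j j<m)) (<⇒≢ (<-≤-trans t<j j≤b))) []
        w    = forward i m (≤⇒≤‴ i≤m) k
        path = forward-path i m _ k ≤-refl path-k outside-k

      route : ∀ {i j} → i ≤ m → j ≤ m → i ≢ j → RainbowPath (at i) (at j)
      route {i} {j} i≤m j≤m i≢j with <-cmp i j
      ... | tri< i<j _   _ = forward-route i<j j≤m
      ... | tri≈ _   i≡j _ = contradiction i≡j i≢j
      ... | tri> _   _   j<i with j ≤? rank a b | rank a b <? i
      ...   | yes j≤b | yes b<i = wrap-route j<i i≤m j≤b b<i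
      ...   | no j≰b  | _       = backward-route j<i i≤m (j≰b ∘′ proj₁)
      ...   | _       | no b≮i  = backward-route j<i i≤m (b≮i ∘′ proj₂)

      rainbowConnected-m : ∃ λ (col : Colouring D m) → RainbowConnected col
      rainbowConnected-m = edgeColouring colour , λ x y x≢y →
        subst₂ RainbowPath (at-rank x) (at-rank y) (route (rank-≤ a x) (rank-≤ a y) (x≢y ∘′ rank-injective a))

    count≤2⇒asym⊆pair : asymArcCount D ≤ 2 → ∃ λ b → b ≢ a × (∀ u → D (σ u) u ≡ false → u ≡ a ⊎ u ≡ b)
    count≤2⇒asym⊆pair count≤2 with FP.any? (λ b → ¬? (b F.≟ a) ×-dec (D (σ b) b Data.Bool.≟ false))
    ... | no no-other = σ a , σ-irreflexive a , only-a
      where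
      only-a : ∀ u → D (σ u) u ≡ false → u ≡ a ⊎ u ≡ σ a
      only-a u u-asym with u F.≟ a
      ... | yes u≡a = inj₁ u≡a
      ... | no u≢a  = contradiction (u , u≢a , u-asym) no-other
    ... | yes (b , b≢a , b-asym)
      with FP.any? (λ c → ¬? (c F.≟ a) ×-dec ¬? (c F.≟ b) ×-dec (D (σ c) c Data.Bool.≟ false))
    ...   | yes (c , c≢a , c≢b , c-asym) = contradiction
      (≤-trans (three-asym⇒3≤count (b≢a ∘′ sym) (c≢a ∘′ sym) (c≢b ∘′ sym) a-asym b-asym c-asym) count≤2)
      (<-irrefl refl)
    ...   | no no-third = b , b≢a , only-ab
      where
      only-ab : ∀ u → D (σ u) u ≡ false → u ≡ a ⊎ u ≡ b
      only-ab u u-asym with u F.≟ a | u F.≟ b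
      ... | yes u≡a | _       = inj₁ u≡a
      ... | no _    | yes u≡b = inj₂ u≡b
      ... | no u≢a  | no u≢b  = contradiction (u , u≢a , u≢b , u-asym) no-third

    rc*≡m : asymArcCount D ≤ 2 → rc*≡ D m
    rc*≡m count≤2 with b , b≢a , asym⊆ ← count≤2⇒asym⊆pair count≤2 =
      TwoAsymmetric.rainbowConnected-m b b≢a asym⊆ , λ _ c<m (col , rc) → <⇒≱ c<m (rainbow⇒m≤ col rc)

    rc*≡N : 3 ≤ asymArcCount D → rc*≡ D N
    rc*≡N 3≤count =
      (let col , src = stronglyRainbowConnected-N in col , strong⇒rainbowConnected src) ,
      λ _ c<N (col , rc) → <⇒≱ c<N (3≤count⇒rainbow⇒N≤ 3≤count col rc)

    src*≡N : 3 ≤ asymArcCount D → src*≡ D N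
    src*≡N 3≤count = stronglyRainbowConnected-N ,
      λ _ c<N (col , src) → <⇒≱ c<N (3≤count⇒rainbow⇒N≤ 3≤count col (strong⇒rainbowConnected src))

asymmetric-arc : ∀ {n} (D : Digraph n) → 1 ≤ asymArcCount D → ∃ λ u → ∃ λ v → Arc D u v × D v u ≡ false
asymmetric-arc {n} D 1≤count
  with u , 1≤row ← sum-map-positive _ (allFin n) 1≤count
  with v , 1≤uv  ← sum-map-positive _ (allFin n) 1≤row
  = u , v , asym (D u v) (D v u) 1≤uv
  where
  asym : ∀ b c → 1 ≤ (if b ∧ not c then 1 else 0) → b ≡ true × c ≡ false
  asym true false _ = refl , refl

orient-along-arc : ∀ {m} (D : Digraph (suc m)) → SubdigraphOfBiorientedCycle D →
  ∀ {u v} → Arc D u v → D v u ≡ false →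
  ∃ λ (O : CyclicOrder m) → ArcsAlong O D × Arc D u (CyclicOrder.σ O u) × D (CyclicOrder.σ O u) u ≡ false
orient-along-arc {m} D sub {u} {v} e asym with sub u v e
... | inj₁ refl = clockwise m , sub , e , asym
... | inj₂ refl = anticlockwise m , along ,
      subst (Arc D (next v)) (sym (prev-next v)) e , subst (λ w → D w (next v) ≡ false) (sym (prev-next v)) asym
  where
  along : ArcsAlong (anticlockwise m) D
  along x y xy with sub x y xy
  ... | inj₁ refl = inj₂ (sym (prev-next x))
  ... | inj₂ refl = inj₁ (sym (prev-next y))

theorem4 : (n : ℕ) → 3 ≤ n → (D : Digraph n) →
    SubdigraphOfBiorientedCycle D → StronglyConnected D →
    1 ≤ asymArcCount D →
    ((asymArcCount D ≤ 2 → rc*≡ D (n ∸ 1)) ×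
     (3 ≤ asymArcCount D → rc*≡ D n × src*≡ D n))
theorem4 (suc (suc (suc _))) (s≤s (s≤s (s≤s z≤n))) D sub sc 1≤count
  with u , _ , e , asym ← asymmetric-arc D 1≤count
  with O , along , a-arc , a-asym ← orient-along-arc D sub e asym
  = rc*≡m sc u a-arc a-asym , λ 3≤count → rc*≡N sc u a-arc a-asym 3≤count , src*≡N sc u a-arc a-asym 3≤count
  where open CycleDigraph (s≤s (s≤s z≤n)) O D along
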